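{- Let $n\ge 1$ and let $s=(s_1,\dots,s_{n+1})\in[n+1]^{n+1}$ be such that $(\mathcal{P}_{n+1},s)$ is a parking function, $s_1=1$, and $s_i \le i-1$ for all $2\le i\le n+1$. Then $\alpha((\mathcal{P}_{n+1},s))$ is a path, i.e. an ordered tree on $n+1$ vertices in which every vertex has at most one child, with its $n$ non-root vertices labeled by $[n]$.
   Context: Rooted trees have edges oriented towards the root; $(u,v)$ denotes the edge $u\to v$. Given $p\in[m]^m$ and a rooted tree on $[m]$, drivers $1,\dots,m$ arrive in order; driver $i$ goes to $p_i$ and parks there if unoccupied; otherwise she travels towards the root and parks at the first unoccupied vertex (crossing the edges on the way); if none, she leaves. The pair is a parking function if all drivers park; it is prime if for every non-root $v$, the number of $i$ with $p_i$ in the subtree $T_v$ of vertices having a directed path to $v$ exceeds $|T_v|$. $\mathcal{P}_{m}$ is the path $1\to2\to\cdots\to m$ with root $m$. An ordered tree has linearly ordered children; post-order labeling labels vertices $1,\dots,m$ in post-order traversal (children left to right). $\mathcal{SRP}_m$ is the set of pairs $(\mathcal{T},p)$, $\mathcal{T}$ an ordered tree on $[m]$ labeled in post-order, $p\in[m]^m$, with $(\mathcal{T},p)$ a prime parking function and such that for siblings $u,v$ with parent $w$, $v$ is right of $u$ iff edge $(v,w)$ is crossed by a driver before $(u,w)$ is. (A pair $(\mathcal{P}_{n+1},s)$ as in the claim is prime and lies in $\mathcal{SRP}_{n+1}$.) The map $\alpha$ from $\mathcal{SRP}_m$ to ordered trees on $m$ vertices with non-root vertices labeled by $[m-1]$ is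 defined recursively. If $m=1$, $\alpha$ gives a single unlabeled vertex. If $m\ge2$, given $(\mathcal{T},p)\in\mathcal{SRP}_m$: park only drivers $1,\dots,m-1$ and call an edge highlighted if one of them crosses it. Delete all non-highlighted edges and the root $m$ (the non-highlighted edges lie on the path from $p_m$ to the root). The remaining components $\mathcal{T}_1,\dots,\mathcal{T}_r$ are indexed in the order they occur along the path from vertex $p_m$ to the root (so $p_m\in\mathcal{T}_1$). Mark the vertex $p_m$ in $\mathcal{T}_1$, and for $i\ge2$ mark the vertex $v\in\mathcal{T}_i$ such that the deleted edge $(u,v)$ has $u$ the root of $\mathcal{T}_{i-1}$. Let $p^{(i)}$ be the subsequence of $(p_1,\dots,p_{m-1})$ of entries lying in $\mathcal{T}_i$ and $A_i=\{j\in[m-1]:p_j\in\mathcal{T}_i\}$ (so $|A_i|=|\mathcal{T}_i|$). If the marked vertex is the $k$-th smallest label of $\mathcal{T}_i$, mark the $k$-th smallest element of $A_i$. Relabel $\mathcal{T}_i$ and $p^{(i)}$ order-preservingly by $[|\mathcal{T}_i|]$ (keeping the inherited sibling order) to get $(\overline{\mathcal{T}}_i,\overline{p}^{(i)})\in\mathcal{SRP}_{|\mathcal{T}_i|}$; compute $Q_i=\alpha((\overline{\mathcal{T}}_i,\overline{p}^{(i)}))$; label the root of $Q_i$ by the marked element of $A_i$ and its non-root vertices (labeled by $[|\mathcal{T}_i|-1]$) by the unmarked elements of $A_i$, preserving relative order, obtaining $P_i$. Then $\alpha((\mathcal{T},p))$ is a new unlabeled root whose children, from left to right, are the roots of $P_1,\dots,P_r$.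 -}

module Defs where

open import Data.Nat using (ℕ; zero; suc; _+_; _∸_; _≤_; _<_)
open import Data.Nat.Properties using (_≟_; _<?_; _≤?_)
open import Data.Bool using (Bool; true; false; if_then_else_; _∧_; _∨_; not; T)
open import Data.List using (List; []; _∷_; map; filter; zip; upTo; take; _++_)
open import Data.Maybe using (Maybe; just; nothing)
open import Data.Product using (_×_; _,_; proj₁; proj₂)
open import Relation.Nullary.Decidable using (⌊_⌋)

-- Vertices of the path P_m are 1,…,m with edges (w , w+1)
-- for 1 ≤ w < m and root m.  The edge (w , w+1) is identified with w.

-- the list a, a+1, …, b  (empty if b < a)
range : ℕ → ℕ → List ℕ
range a b = map (a +_) (upTo (suc b ∸ a))

bfilter : {A : Set} → (A → Bool) → List A → List A
bfilter f [] = []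
bfilter f (x ∷ xs) = if f x then x ∷ bfilter f xs else bfilter f xs

anyB : {A : Set} → (A → Bool) → List A → Bool
anyB f [] = false
anyB f (x ∷ xs) = f x ∨ anyB f xs

elem : ℕ → List ℕ → Bool
elem x [] = false
elem x (y ∷ ys) = ⌊ x ≟ y ⌋ ∨ elem x ys

-- 1-indexed lookup with default 0
nth : List ℕ → ℕ → ℕ
nth [] _ = 0
nth (x ∷ xs) zero = 0
nth (x ∷ xs) (suc zero) = x
nth (x ∷ xs) (suc (suc i)) = nth xs (suc i)

-- remove the k-th (1-indexed) element
removeAt : List ℕ → ℕ → List ℕ
removeAt [] _ = []
removeAt (x ∷ xs) zero = x ∷ xs
removeAt (x ∷ xs) (suc zero) = xs
removeAt (x ∷ xs) (suc (suc i)) = x ∷ removeAt xs (suc i)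

firstFree : ℕ → ℕ → ℕ → List ℕ → Maybe ℕ
firstFree zero m v occ = nothing
firstFree (suc f) m v occ =
  if ⌊ m <? v ⌋ then nothing
  else (if elem v occ then firstFree f m (suc v) occ else just v)

-- Returns (occupied vertices , all drivers parked? , crossing intervals)
-- where an interval (v , e) means the driver crossed the edges w with v ≤ w < e
-- (a driver who finds no spot crosses every edge up to the root m).
parkRun : ℕ → List ℕ → List ℕ → List (ℕ × ℕ) → Bool → List ℕ × Bool × List (ℕ × ℕ)
parkRun m [] occ cr ok = occ , ok , cr
parkRun m (v ∷ ps) occ cr ok with firstFree (suc m) m v occ
... | just s  = parkRun m ps (s ∷ occ) ((v , s) ∷ cr) ok
... | nothing = parkRun m ps occ ((v , m) ∷ cr) false

IsParkingFunctionPath : ℕ → List ℕ → Set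
IsParkingFunctionPath m p = T (proj₁ (proj₂ (parkRun m p [] [] true)))

highlighted : ℕ → List ℕ → ℕ → Bool
highlighted m ps w =
  anyB (λ ve → ⌊ proj₁ ve ≤? w ⌋ ∧ ⌊ w <? proj₂ ve ⌋) (proj₂ (proj₂ (parkRun m ps [] [] true)))

data LTree : Set where
  node : ℕ → List LTree → LTree

mutual
  relabel : (ℕ → ℕ) → LTree → LTree
  relabel f (node l ts) = node (f l) (relabelF f ts)

  relabelF : (ℕ → ℕ) → List LTree → List LTree
  relabelF f [] = []
  relabelF f (t ∷ ts) = relabel f t ∷ relabelF f ts

mutual
  labels : LTree → List ℕ
  labels (node l ts) = l ∷ labelsF ts

  labelsF : List LTree → List ℕ
  labelsF [] = []
  labelsF (t ∷ ts) = labels t ++ labelsF ts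

-- An ordered tree whose root is unlabeled and whose non-root vertices are
-- labeled is represented by the list of (labeled) subtrees of its root.
UnlabeledRootTree : Set
UnlabeledRootTree = List LTree

-- The map α, for inputs whose tree is the path P_m.
-- (Every component of P_m minus its root and some edges is again a path,
--  so the recursion of α stays within paths.)
-- αF fuel m p  with p = (p_1,…,p_m); fuel ≥ m guarantees termination.

-- components of P_m after deleting root m and non-highlighted edges:
-- intervals (lo , hi) of [1 , m-1], listed from p_m towards the root
components : ℕ → List ℕ → List (ℕ × ℕ)
components m ps = zip (1 ∷ map suc cuts) (cuts ++ ((m ∸ 1) ∷ []))
  where
  cuts : List ℕ
  cuts = bfilter (λ w → not (highlighted m ps w)) (range 1 (m ∸ 2))

αF : ℕ → ℕ → List ℕ → UnlabeledRootTree
αF zero m p = []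
αF (suc f) zero p = []
αF (suc f) (suc zero) p = []
αF (suc f) (suc (suc k)) p = build (components m ps)
  where
  m : ℕ
  m = suc (suc k)
  ps : List ℕ
  ps = take (m ∸ 1) p
  pm : ℕ
  pm = nth p m
  idx : List (ℕ × ℕ)
  idx = zip (range 1 (m ∸ 1)) ps
  comp : ℕ × ℕ → LTree
  comp (lo , hi) = node markedA (relabelF (λ l → nth unmarked l) Q)
    where
    inT : ℕ → Bool
    inT x = ⌊ lo ≤? x ⌋ ∧ ⌊ x ≤? hi ⌋
    sel : List (ℕ × ℕ)
    sel = bfilter (λ jp → inT (proj₂ jp)) idx
    A : List ℕ
    A = map proj₁ sel
    pbar : List ℕ              -- p^(i) relabeled order-preservingly
    pbar = map (λ jp → suc (proj₂ jp ∸ lo)) sel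
    markedV : ℕ
    markedV = if inT pm then pm else lo
    kk : ℕ
    kk = suc (markedV ∸ lo)
    markedA : ℕ
    markedA = nth A kk
    unmarked : List ℕ
    unmarked = removeAt A kk
    Q : UnlabeledRootTree
    Q = αF f (suc hi ∸ lo) pbar
  build : List (ℕ × ℕ) → List LTree
  build [] = []
  build (c ∷ cs) = comp c ∷ build cs

α-path : ℕ → List ℕ → UnlabeledRootTree
α-path m p = αF m m p

data PathTree : LTree → Set where
  leaf : ∀ l → PathTree (node l [])
  step : ∀ l t → PathTree t → PathTree (node l (t ∷ []))

data IsPath : UnlabeledRootTree → Set where
  root-leaf : IsPath []
  root-step : ∀ t → PathTree t → IsPath (t ∷ [])

-- Under the hypotheses the first i drivers fill the vertices 1, …, i, so driver i + 1,
-- whose preference is at most i, parks at i + 1 after crossing the edge (i , i + 1).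
-- Hence among the first n drivers every edge below the root is highlighted, α has a
-- single component, namely P_n with the preferences (s₁, …, sₙ), which again satisfy
-- the hypotheses; by induction α of it is a path, and α(P_{n+1}, s) is that path with
-- its root labelled and a new unlabelled root on top.
module Submission where

open import Defs
open import Data.Nat using (ℕ; suc; _≤_)
open import Data.Fin using (Fin; toℕ; zero)
open import Data.Vec using (Vec; lookup; toList)
open import Data.Product using (_×_)
open import Relation.Binary.PropositionalEquality using (_≡_)
open import Data.List.Relation.Binary.Permutation.Propositional using (_↭_)

open import Data.Nat using (zero; _+_; _∸_; _<_; _⊓_; z≤n; s≤s)
open import Data.Nat.Properties
open import Data.Bool using (Bool; true; false; if_then_else_; _∧_; _∨_; not)
open import Data.Bool.Properties using (∨-zeroʳ)
open import Data.List using (List; []; _∷_; _++_; map; zip; take; length; applyUpTo)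
open import Data.List.Properties using (length-applyUpTo; map-applyUpTo; length-take; ++-identityʳ; map-++; map-∘; map-id-local)
open import Data.List.Relation.Unary.All as All using (All; []; _∷_)
open import Data.List.Relation.Unary.All.Properties using (applyUpTo⁺₁)
open import Data.List.Relation.Binary.Permutation.Propositional using (↭-refl; ↭-trans; ↭-prep; ↭-swap; module PermutationReasoning)
open import Data.List.Relation.Binary.Permutation.Propositional.Properties using (map⁺)
open import Data.Maybe using (just; nothing)
open import Data.Product using (_,_; proj₁; proj₂)
open import Data.Unit using (⊤; tt)
open import Data.Empty using (⊥-elim)
open import Data.Fin using () renaming (suc to fsuc)
open import Data.Vec using () renaming (_∷_ to _∷ᵥ_; [] to []ᵥ)
open import Data.Vec.Properties using (length-toList)
open import Relation.Nullary using (Dec; yes; no)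
open import Relation.Nullary.Decidable using (⌊_⌋; dec-true; isYes≗does)
open import Relation.Binary.PropositionalEquality using (refl; sym; trans; cong; cong₂; subst; module ≡-Reasoning)

bfilter-all : {A : Set} (f : A → Bool) (xs : List A) →
              All (λ x → f x ≡ true) xs → bfilter f xs ≡ xs
bfilter-all f []       []         = refl
bfilter-all f (x ∷ xs) (fx ∷ fxs) rewrite fx = cong (x ∷_) (bfilter-all f xs fxs)

bfilter-none : {A : Set} (f : A → Bool) (xs : List A) →
               All (λ x → f x ≡ false) xs → bfilter f xs ≡ []
bfilter-none f []       []         = refl
bfilter-none f (x ∷ xs) (fx ∷ fxs) rewrite fx = bfilter-none f xs fxs

All-zip-proj₂ : {A B : Set} {P : B → Set} (xs : List A) {ys : List B} →
                All P ys → All (λ xy → P (proj₂ xy)) (zip xs ys)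
All-zip-proj₂ []       _          = []
All-zip-proj₂ (x ∷ xs) []         = []
All-zip-proj₂ (x ∷ xs) (py ∷ pys) = py ∷ All-zip-proj₂ xs pys

map-proj₁-zip : {A B : Set} (xs : List A) (ys : List B) →
                length xs ≡ length ys → map proj₁ (zip xs ys) ≡ xs
map-proj₁-zip []       _        _   = refl
map-proj₁-zip (x ∷ xs) (y ∷ ys) len = cong (x ∷_) (map-proj₁-zip xs ys (suc-injective len))

map-proj₂-zip : {A B : Set} (xs : List A) (ys : List B) →
                length xs ≡ length ys → map proj₂ (zip xs ys) ≡ ys
map-proj₂-zip []       []       _   = refl
map-proj₂-zip (x ∷ xs) (y ∷ ys) len = cong (y ∷_) (map-proj₂-zip xs ys (suc-injective len))

nth∷removeAt↭ : ∀ xs j → 1 ≤ j → j ≤ length xs → nth xs j ∷ removeAt xs j ↭ xs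
nth∷removeAt↭ (x ∷ xs) 1               _ _         = ↭-refl
nth∷removeAt↭ (x ∷ xs) (suc (suc j)) _ (s≤s j<) =
  ↭-trans (↭-swap _ _ ↭-refl) (↭-prep x (nth∷removeAt↭ xs (suc j) (s≤s z≤n) j<))

length-removeAt : ∀ xs j → 1 ≤ j → j ≤ length xs → suc (length (removeAt xs j)) ≡ length xs
length-removeAt (x ∷ xs) 1               _ _        = refl
length-removeAt (x ∷ xs) (suc (suc j)) _ (s≤s j<) = cong suc (length-removeAt xs (suc j) (s≤s z≤n) j<)

range1≡applyUpTo-suc : ∀ n → range 1 n ≡ applyUpTo suc n
range1≡applyUpTo-suc n = map-applyUpTo (λ i → i) (1 +_) n

length-range1 : ∀ n → length (range 1 n) ≡ n
length-range1 n rewrite range1≡applyUpTo-suc n = length-applyUpTo suc n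

map-nth-range1 : ∀ xs → map (nth xs) (range 1 (length xs)) ≡ xs
map-nth-range1 xs rewrite range1≡applyUpTo-suc (length xs) =
  trans (map-applyUpTo suc (nth xs) (length xs)) (applyUpTo-nth xs)
  where
  applyUpTo-nth : ∀ ys → applyUpTo (λ i → nth ys (suc i)) (length ys) ≡ ys
  applyUpTo-nth []       = refl
  applyUpTo-nth (y ∷ ys) = cong (y ∷_) (applyUpTo-nth ys)

⌊⌋-true : {A : Set} (a? : Dec A) → A → ⌊ a? ⌋ ≡ true
⌊⌋-true a? a = trans (isYes≗does a?) (dec-true a? a)

InRange : ℕ → ℕ → Set
InRange b x = 1 ≤ x × x ≤ b

inRange : ℕ → ℕ → Bool
inRange b x = ⌊ 1 ≤? x ⌋ ∧ ⌊ x ≤? b ⌋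

inRange-true : ∀ {b x} → InRange b x → inRange b x ≡ true
inRange-true {b} {x} (1≤x , x≤b) = cong₂ _∧_ (⌊⌋-true (1 ≤? x) 1≤x) (⌊⌋-true (x ≤? b) x≤b)

All-InRange-range1 : ∀ n → All (InRange n) (range 1 n)
All-InRange-range1 n rewrite range1≡applyUpTo-suc n = applyUpTo⁺₁ suc n (λ i<n → s≤s z≤n , i<n)

Staircase : ℕ → List ℕ → Set
Staircase i []       = ⊤
Staircase i (q ∷ qs) = InRange i q × Staircase (suc i) qs

Staircase-take : ∀ n {i} qs → Staircase i qs → Staircase i (take n qs)
Staircase-take zero    qs       _          = tt
Staircase-take (suc n) []       _          = tt
Staircase-take (suc n) (q ∷ qs) (q∈ , qs∈) = q∈ , Staircase-take n qs qs∈

Staircase-bounded : ∀ i qs → Staircase i qs → All (InRange (i + length qs)) qs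
Staircase-bounded i []       _                 = []
Staircase-bounded i (q ∷ qs) ((1≤q , q≤i) , st) =
  (1≤q , ≤-trans q≤i (m≤m+n i _)) ∷
  All.map (λ (1≤x , x≤) → 1≤x , ≤-trans x≤ (≤-reflexive (sym (+-suc i (length qs)))))
          (Staircase-bounded (suc i) qs st)

descending : ℕ → List ℕ
descending zero    = []
descending (suc i) = suc i ∷ descending i

elem-descending : ∀ {x} i → InRange i x → elem x (descending i) ≡ true
elem-descending zero    (1≤x , x≤0) = ⊥-elim (<⇒≱ 1≤x x≤0)
elem-descending {x} (suc i) (1≤x , x≤) with x ≟ suc i
... | yes _   = refl
... | no  x≢ = elem-descending i (1≤x , ≤-pred (≤∧≢⇒< x≤ x≢))

elem-descending-> : ∀ {x} i → i < x → elem x (descending i) ≡ false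
elem-descending-> zero    _ = refl
elem-descending-> {x} (suc i) i<x with x ≟ suc i
... | yes refl = ⊥-elim (<-irrefl refl i<x)
... | no  _    = elem-descending-> i (<-trans (n<1+n i) i<x)

firstFree-descending : ∀ fuel m v i → InRange (suc i) v → suc i ≤ m → suc i ∸ v < fuel →
                       firstFree fuel m v (descending i) ≡ just (suc i)
firstFree-descending (suc fuel) m v i (1≤v , v≤) i<m fuel> with m <? v
... | yes m<v = ⊥-elim (<⇒≱ m<v (≤-trans v≤ i<m))
... | no  _ with v ≤? i
...   | yes v≤i rewrite elem-descending i (1≤v , v≤i) =
          firstFree-descending fuel m (suc v) i (s≤s z≤n , s≤s v≤i) i<m
            (≤-pred (subst (_< suc fuel) (+-∸-assoc 1 v≤i) fuel>))
...   | no  v≰i rewrite elem-descending-> i (≰⇒> v≰i) =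
          cong just (≤-antisym v≤ (≰⇒> v≰i))

crossings : ℕ → List ℕ → List ℕ → List (ℕ × ℕ) → Bool → List (ℕ × ℕ)
crossings m ps occ cr ok = proj₂ (proj₂ (parkRun m ps occ cr ok))

crosses : ℕ → ℕ × ℕ → Bool
crosses w ve = ⌊ proj₁ ve ≤? w ⌋ ∧ ⌊ w <? proj₂ ve ⌋

crosses-true : ∀ {w v e} → v ≤ w → w < e → crosses w (v , e) ≡ true
crosses-true {w} {v} {e} v≤w w<e = cong₂ _∧_ (⌊⌋-true (v ≤? w) v≤w) (⌊⌋-true (w <? e) w<e)

anyB-crossings-mono : ∀ m ps occ cr ok (f : ℕ × ℕ → Bool) →
                      anyB f cr ≡ true → anyB f (crossings m ps occ cr ok) ≡ true
anyB-crossings-mono m []       occ cr ok f fcr = fcr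
anyB-crossings-mono m (v ∷ ps) occ cr ok f fcr with firstFree (suc m) m v occ
... | just s  = anyB-crossings-mono m ps (s ∷ occ) ((v , s) ∷ cr) ok f
                  (trans (cong (f (v , s) ∨_) fcr) (∨-zeroʳ _))
... | nothing = anyB-crossings-mono m ps occ ((v , m) ∷ cr) false f
                  (trans (cong (f (v , m) ∨_) fcr) (∨-zeroʳ _))

Staircase-crosses : ∀ m i qs cr ok → Staircase i qs → i + length qs ≤ m →
                    ∀ w → i ≤ w → w < i + length qs →
                    anyB (crosses w) (crossings m qs (descending i) cr ok) ≡ true
Staircase-crosses m i []       cr ok _          _  w i≤w w< =
  ⊥-elim (<⇒≱ w< (subst (_≤ w) (sym (+-identityʳ i)) i≤w))
Staircase-crosses m i (q ∷ qs) cr ok (q∈ , qs∈) fits w i≤w w<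
  rewrite firstFree-descending (suc m) m q i (proj₁ q∈ , m≤n⇒m≤1+n (proj₂ q∈))
            (≤-trans (m<m+n i (s≤s z≤n)) fits)
            (s≤s (≤-trans (m∸n≤m (suc i) q) (≤-trans (m<m+n i (s≤s z≤n)) fits)))
  with i ≟ w
... | yes refl = anyB-crossings-mono m qs (descending (suc i)) ((q , suc i) ∷ cr) ok (crosses i)
                   (cong (_∨ anyB (crosses i) cr) (crosses-true (proj₂ q∈) (n<1+n i)))
... | no  i≢w  = Staircase-crosses m (suc i) qs ((q , suc i) ∷ cr) ok qs∈
                   (subst (_≤ m) (+-suc i (length qs)) fits) w
                   (≤∧≢⇒< i≤w i≢w) (subst (w <_) (+-suc i (length qs)) w<)

Staircase-highlighted : ∀ k q → Staircase 1 q → length q ≡ k →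
                        ∀ {w} → InRange k w → highlighted (suc (suc k)) (1 ∷ q) w ≡ true
Staircase-highlighted k q st refl {w} (1≤w , w≤k) =
  -- driver 1 parks at vertex 1 and leaves the run in the state (descending 1 , (1 , 1) ∷ [])
  Staircase-crosses (suc (suc k)) 1 q ((1 , 1) ∷ []) true st (n≤1+n _) w 1≤w (s≤s w≤k)

components-staircase : ∀ k q → Staircase 1 q → length q ≡ k →
                       components (suc (suc k)) (1 ∷ q) ≡ (1 , suc k) ∷ []
components-staircase k q st len
  rewrite bfilter-none (λ w → not (highlighted (suc (suc k)) (1 ∷ q) w)) (range 1 k)
            (All.map (λ w∈ → cong not (Staircase-highlighted k q st len w∈)) (All-InRange-range1 k))
  = refl

IsPathLabelledBy : List ℕ → UnlabeledRootTree → Set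
IsPathLabelledBy L T = IsPath T × labelsF T ↭ L

mutual
  labels-relabel : ∀ g t → labels (relabel g t) ≡ map g (labels t)
  labels-relabel g (node l ts) = cong (g l ∷_) (labelsF-relabel g ts)

  labelsF-relabel : ∀ g ts → labelsF (relabelF g ts) ≡ map g (labelsF ts)
  labelsF-relabel g []       = refl
  labelsF-relabel g (t ∷ ts) rewrite labels-relabel g t | labelsF-relabel g ts =
    sym (map-++ g (labels t) (labelsF ts))

PathTree-relabel : ∀ g {t} → PathTree t → PathTree (relabel g t)
PathTree-relabel g (leaf l)     = leaf (g l)
PathTree-relabel g (step l t p) = step (g l) (relabel g t) (PathTree-relabel g p)

hang-relabelled : ∀ {k} xs j Q → 1 ≤ j → j ≤ length xs → length xs ≡ suc k →
                  IsPathLabelledBy (range 1 k) Q →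
                  IsPathLabelledBy xs (node (nth xs j) (relabelF (nth (removeAt xs j)) Q) ∷ [])
hang-relabelled {k} xs j Q 1≤j j≤ len (isPath , Q↭) = root-step _ (hang isPath) , xs↭
  where
  g : ℕ → ℕ
  g = nth (removeAt xs j)

  hang : ∀ {Q} → IsPath Q → PathTree (node (nth xs j) (relabelF g Q))
  hang root-leaf          = leaf _
  hang (root-step t path) = step _ (relabel g t) (PathTree-relabel g path)

  length-rest : length (removeAt xs j) ≡ k
  length-rest = suc-injective (trans (length-removeAt xs j 1≤j j≤) len)

  open PermutationReasoning
  xs↭ : labelsF (node (nth xs j) (relabelF g Q) ∷ []) ↭ xs
  xs↭ = begin
    (nth xs j ∷ labelsF (relabelF g Q)) ++ []
      ≡⟨ ++-identityʳ _ ⟩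
    nth xs j ∷ labelsF (relabelF g Q)
      ≡⟨ cong (nth xs j ∷_) (labelsF-relabel g Q) ⟩
    nth xs j ∷ map g (labelsF Q)
      ↭⟨ ↭-prep _ (map⁺ g Q↭) ⟩
    nth xs j ∷ map g (range 1 k)
      ≡⟨ cong (λ n → nth xs j ∷ map g (range 1 n)) (sym length-rest) ⟩
    nth xs j ∷ map g (range 1 (length (removeAt xs j)))
      ≡⟨ cong (nth xs j ∷_) (map-nth-range1 (removeAt xs j)) ⟩
    nth xs j ∷ removeAt xs j
      ↭⟨ nth∷removeAt↭ xs j 1≤j j≤ ⟩
    xs ∎

selected : ℕ → List ℕ → List (ℕ × ℕ)
selected k p = bfilter (λ jp → inRange (suc k) (proj₂ jp)) (zip (range 1 (suc k)) (take (suc k) p))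

markedRank : ℕ → List ℕ → ℕ
markedRank k p = suc ((if inRange (suc k) pₘ then pₘ else 1) ∸ 1)
  where
  pₘ : ℕ
  pₘ = nth p (suc (suc k))

markedRank-≤ : ∀ k p → markedRank k p ≤ suc k
markedRank-≤ k p with 1 ≤? nth p (suc (suc k)) | nth p (suc (suc k)) ≤? suc k
... | yes _ | yes pₘ≤ = s≤s (∸-monoˡ-≤ 1 pₘ≤)
... | yes _ | no  _   = s≤s z≤n
... | no  _ | _       = s≤s z≤n

α-path-one-component :
  ∀ k p → components (suc (suc k)) (take (suc k) p) ≡ (1 , suc k) ∷ [] →
  let A = map proj₁ (selected k p)
      r = markedRank k p
  in α-path (suc (suc k)) p
     ≡ node (nth A r)
            (relabelF (nth (removeAt A r))
                      (α-path (suc k) (map (λ jp → suc (proj₂ jp ∸ 1)) (selected k p))))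
       ∷ []
α-path-one-component k p comp rewrite comp = refl

α-path-step :
  ∀ k p → components (suc (suc k)) (take (suc k) p) ≡ (1 , suc k) ∷ [] →
  length (take (suc k) p) ≡ suc k → All (InRange (suc k)) (take (suc k) p) →
  IsPathLabelledBy (range 1 k) (α-path (suc k) (take (suc k) p)) →
  IsPathLabelledBy (range 1 (suc k)) (α-path (suc (suc k)) p)
α-path-step k p comp len bounds ih =
  subst (IsPathLabelledBy R)
        (sym (trans (α-path-one-component k p comp) (cong₂ hang labels≡R prefs≡ps)))
        (hang-relabelled R r (α-path (suc k) ps) (s≤s z≤n)
           (≤-trans (markedRank-≤ k p) (≤-reflexive (sym (length-range1 (suc k)))))
           (length-range1 (suc k)) ih)
  where
  R ps : List ℕ
  R  = range 1 (suc k)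
  ps = take (suc k) p

  r : ℕ
  r = markedRank k p

  hang : List ℕ → List ℕ → UnlabeledRootTree
  hang A pbar = node (nth A r) (relabelF (nth (removeAt A r)) (α-path (suc k) pbar)) ∷ []

  lens : length R ≡ length ps
  lens = trans (length-range1 (suc k)) (sym len)

  selected≡zip : selected k p ≡ zip R ps
  selected≡zip = bfilter-all _ _ (All-zip-proj₂ R (All.map inRange-true bounds))

  suc-∸1 : ∀ {x} → 1 ≤ x → suc (x ∸ 1) ≡ x
  suc-∸1 (s≤s _) = refl

  labels≡R : map proj₁ (selected k p) ≡ R
  labels≡R = trans (cong (map proj₁) selected≡zip) (map-proj₁-zip R ps lens)

  prefs≡ps : map (λ jp → suc (proj₂ jp ∸ 1)) (selected k p) ≡ ps
  prefs≡ps = begin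
    map (λ jp → suc (proj₂ jp ∸ 1)) (selected k p)  ≡⟨ cong (map (λ jp → suc (proj₂ jp ∸ 1))) selected≡zip ⟩
    map (λ jp → suc (proj₂ jp ∸ 1)) (zip R ps)      ≡⟨ map-∘ {g = λ x → suc (x ∸ 1)} {f = proj₂} (zip R ps) ⟩
    map (λ x → suc (x ∸ 1)) (map proj₂ (zip R ps))  ≡⟨ cong (map (λ x → suc (x ∸ 1))) (map-proj₂-zip R ps lens) ⟩
    map (λ x → suc (x ∸ 1)) ps                      ≡⟨ map-id-local (All.map (λ (1≤x , _) → suc-∸1 1≤x) bounds) ⟩
    ps                                              ∎
    where open ≡-Reasoning

α-path-staircase : ∀ k q → Staircase 1 q → length q ≡ k →
                   IsPathLabelledBy (range 1 k) (α-path (suc k) (1 ∷ q))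
α-path-staircase zero    q _  _   = root-leaf , ↭-refl
α-path-staircase (suc k) q st len =
  α-path-step k (1 ∷ q) (components-staircase k q′ st′ len′) (cong suc len′) bounds
    (α-path-staircase k q′ st′ len′)
  where
  q′ : List ℕ
  q′ = take k q

  st′ : Staircase 1 q′
  st′ = Staircase-take k q st

  len′ : length q′ ≡ k
  len′ = trans (length-take k q) (trans (cong (k ⊓_) len) (m≤n⇒m⊓n≡m (n≤1+n k)))

  bounds : All (InRange (suc k)) (1 ∷ q′)
  bounds = (s≤s z≤n , s≤s z≤n) ∷ subst (λ n → All (InRange n) q′) (cong suc len′) (Staircase-bounded 1 q′ st′)

Staircase-toList : ∀ i {n} (v : Vec ℕ n) → (∀ j → InRange (i + toℕ j) (lookup v j)) → Staircase i (toList v)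
Staircase-toList i []ᵥ      _  = tt
Staircase-toList i (x ∷ᵥ v) v∈ =
  subst (λ b → InRange b x) (+-identityʳ i) (v∈ zero) ,
  Staircase-toList (suc i) v (λ j → subst (λ b → InRange b (lookup v j)) (+-suc i (toℕ j)) (v∈ (fsuc j)))

proposition5p1 : (n : ℕ) → 1 ≤ n → (s : Vec ℕ (suc n))
    → (∀ (i : Fin (suc n)) → 1 ≤ lookup s i × lookup s i ≤ suc n)
    → IsParkingFunctionPath (suc n) (toList s)
    → lookup s zero ≡ 1
    → (∀ (i : Fin (suc n)) → 1 ≤ toℕ i → lookup s i ≤ toℕ i)
    → IsPath (α-path (suc n) (toList s)) × (labelsF (α-path (suc n) (toList s)) ↭ range 1 n)
proposition5p1 n _ (.1 ∷ᵥ s′) bounds _ refl below =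
  α-path-staircase n (toList s′)
    (Staircase-toList 1 s′ (λ j → proj₁ (bounds (fsuc j)) , below (fsuc j) (s≤s z≤n)))
    (length-toList s′)
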